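{- Let $m\ge 2$ and $\pi\in W_n^{ -1}(P_m)$. Then the vertices of the copy of $P_m$ in $W(\pi)$ can be labeled $p_0,p_1,\dots,p_m$, with $p_i$ adjacent to $p_{i+1}$ for $0\le i\le m-1$, such that: (i) the term of $\pi$ corresponding to $p_i$ lies to the left of the term corresponding to $p_{i+1}$, for $0\le i\le m-2$; (ii) the term corresponding to $p_m$ lies to the right of the term corresponding to $p_{m-2}$; (iii) if $\pi_{i_1}$ and $\pi_{i_m}$ are the terms corresponding to $p_1$ and $p_m$ respectively, then $\pi_{i_m}<\pi_{i_1}$.
   Context: For $\pi=\pi_1\cdots\pi_n\in\mathcal{S}_n$, the digraph $D(\pi)$ has vertices $1,\dots,n$ (vertex $i$ identified with the term $\pi_i$) and an arc from $j$ to $i$ whenever $i<j$ and $\pi_i<\pi_j$. The weighted competition graph $W(\pi)$ is the edge-weighted simple graph on the same vertices in which distinct $u,v$ are joined by an edge iff they have a common out-neighbor in $D(\pi)$, and the weight of the edge $uv$ is the number of common out-neighbors of $u$ and $v$. $P_m$ denotes the path with $m+1$ vertices and $m$ edges, all of weight $1$. For an edge-weighted graph $G$, $W_n^{ -1}(G)$ is the set of $\pi\in\mathcal{S}_n$ such that $W(\pi)$ is isomorphic, as an edge-weighted graph, to $G$ together with some number of isolated vertices. -}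

module Defs where

open import Data.Nat using (ℕ; zero; suc; _+_)
open import Data.Fin using (Fin; toℕ; _<_; _<?_)
open import Data.Fin.Permutation using (Permutation′; _⟨$⟩ʳ_)
open import Data.List using (List; length; filter; allFin)
open import Data.Product using (Σ; _×_; _,_)
open import Relation.Binary.PropositionalEquality using (_≡_; _≢_)
open import Relation.Nullary using (¬_; Dec)
open import Relation.Nullary.Decidable using (_×-dec_)
open import Function.Definitions using (Injective)

-- the term π_i of the permutation π = π_1 ⋯ π_n (positions/values are Fin n, 0-based)
term : ∀ {n} → Permutation′ n → Fin n → Fin n
term π i = π ⟨$⟩ʳ i

-- arc j → i in D(π) iff i < j and π_i < π_j
Arc : ∀ {n} → Permutation′ n → Fin n → Fin n → Set
Arc π j i = (i < j) × (term π i < term π j)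

arc? : ∀ {n} (π : Permutation′ n) (j i : Fin n) → Dec (Arc π j i)
arc? π j i = (i <? j) ×-dec (term π i <? term π j)

-- number of common out-neighbours of u and v in D(π)
-- (= weight of the edge uv in W(π) for u ≠ v; 0 means "no edge")
weight : ∀ {n} → Permutation′ n → Fin n → Fin n → ℕ
weight {n} π u v = length (filter (λ k → arc? π u k ×-dec arc? π v k) (allFin n))

-- an edge-weighted simple graph on k vertices, given by its weight function
-- (weight 0 = no edge; only values at distinct vertices matter)
WGraph : ℕ → Set
WGraph k = Fin k → Fin k → ℕ

∣_-_∣ : ℕ → ℕ → ℕ
∣ zero - b ∣ = b
∣ suc a - zero ∣ = suc a
∣ suc a - suc b ∣ = ∣ a - b ∣

P : (m : ℕ) → WGraph (suc m)
P m a b with ∣ toℕ a - toℕ b ∣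
... | 1 = 1
... | _ = 0

InImage : ∀ {k n} → (Fin k → Fin n) → Fin n → Set
InImage {k} f u = Σ (Fin k) (λ a → f a ≡ u)

-- f : V(G) → V(W(π)) is an isomorphism of G onto W(π) minus isolated vertices,
-- i.e. f witnesses W(π) ≅ G + (isolated vertices)
IsIsoEmbedding : ∀ {k n} → Permutation′ n → WGraph k → (Fin k → Fin n) → Set
IsIsoEmbedding π G f =
  Injective _≡_ _≡_ f
  × (∀ a b → a ≢ b → weight π (f a) (f b) ≡ G a b)
  × (∀ u v → u ≢ v → ¬ InImage f u → weight π u v ≡ 0)

InWInv : ∀ {k n} → Permutation′ n → WGraph k → Set
InWInv {k} {n} π G = Σ (Fin k → Fin n) (IsIsoEmbedding π G)

module Submission where

-- Positions are the vertices of D(π) (left = smaller index), and a vertex x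
-- points to z in D(π) iff z lies left of x with a smaller term.  Let f embed the
-- path P_m = 0 - 1 - ⋯ - m into W(π) and write F j = f j.  Each edge j(j+1) gives
-- a common out-neighbour K j of F j and F (j+1), its "sink", and the only
-- in-neighbours of K j are F j and F (j+1): a third one would share an
-- out-neighbour with both, hence be a path vertex adjacent to both j and j+1.
-- Only this description of the sinks (the record SinkPath) is used afterwards:
--   * no sink points to another, so further right means smaller term, and
--     distinct edges have distinct sinks;
--   * no sink lies strictly between K j and K (j+1), since F (j+1) would point to it;
--   * hence K 0, K 1, …, K (m-1) are monotone in position (zigzag, chain).
-- Reversing the path reverses the sinks, so we may take them increasing; then
-- each claim of the theorem follows because F a cannot point to a sink of an edge
-- not containing a.

open import Defs
open import Data.Nat using (ℕ; suc; _+_; _≤_)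
open import Data.Fin using (Fin; toℕ; fromℕ; _<_)
open import Data.Fin.Permutation using (Permutation′)
open import Data.Product using (Σ; _×_)
open import Relation.Binary.PropositionalEquality using (_≡_)

open import Data.Nat using (zero; _∸_; z≤n; s≤s)
import Data.Nat as Nat
import Data.Nat.Properties as NatP
open import Data.Fin using (opposite) renaming (_≤_ to _≤ᶠ_)
import Data.Fin as Fin
import Data.Fin.Properties as FinP
open import Data.Product using (_,_; proj₁; proj₂)
open import Data.Sum using (_⊎_; inj₁; inj₂)
import Data.Sum as Sum
open import Data.Empty using (⊥; ⊥-elim)
open import Function using (_∘_)
open import Data.List using ([]; _∷_; filter; allFin)
open import Data.List.Relation.Unary.Any using (here)
import Data.List.Relation.Unary.Any as Any
open import Data.List.Membership.Propositional using (_∈_)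
open import Data.List.Membership.Propositional.Properties using (∈-filter⁻; ∈-allFin)
open import Data.List.Properties using (filter-some)
open import Relation.Binary.PropositionalEquality using (_≢_; refl; sym; trans; cong; cong₂; subst; subst₂; module ≡-Reasoning)
open import Relation.Nullary using (¬_; yes; no)
open import Relation.Nullary.Decidable using (_×-dec_)
open import Relation.Unary using (Decidable)
open import Relation.Binary using (tri<; tri≈; tri>)
open import Relation.Binary.Bundles using (StrictTotalOrder)

distance-suc : ∀ j → ∣ j - suc j ∣ ≡ 1
distance-suc zero = refl
distance-suc (suc j) = distance-suc j

-- no number is at distance one from both j and j+1 (parity)
distance-parity : ∀ a j → ∣ a - j ∣ ≡ 1 → ∣ a - suc j ∣ ≡ 1 → ⊥
distance-parity zero zero () _
distance-parity zero (suc zero) _ ()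
distance-parity zero (suc (suc j)) () _
distance-parity (suc zero) zero _ ()
distance-parity (suc (suc a)) zero () _
distance-parity (suc a) (suc j) d₁ d₂ = distance-parity a j d₁ d₂

distance-std : ∀ a b → ∣ a - b ∣ ≡ Nat.∣ a - b ∣
distance-std zero b = refl
distance-std (suc a) zero = refl
distance-std (suc a) (suc b) = distance-std a b

distance-reflect : ∀ m x y → x ≤ m → y ≤ m → ∣ m ∸ x - m ∸ y ∣ ≡ ∣ x - y ∣
distance-reflect m x y x≤m y≤m = begin
  ∣ m ∸ x - m ∸ y ∣                       ≡⟨ distance-std (m ∸ x) (m ∸ y) ⟩
  Nat.∣ m ∸ x - m ∸ y ∣                   ≡⟨ NatP.∣m+n-m+o∣≡∣n-o∣ y (m ∸ x) (m ∸ y) ⟨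
  Nat.∣ y + (m ∸ x) - y + (m ∸ y) ∣       ≡⟨ cong (λ t → Nat.∣ y + (m ∸ x) - t ∣) (NatP.m+[n∸m]≡n y≤m) ⟩
  Nat.∣ y + (m ∸ x) - m ∣                 ≡⟨ NatP.∣-∣-comm (y + (m ∸ x)) m ⟩
  Nat.∣ m - y + (m ∸ x) ∣                 ≡⟨ cong₂ Nat.∣_-_∣ (NatP.m∸n+n≡m x≤m) (NatP.+-comm (m ∸ x) y) ⟨
  Nat.∣ (m ∸ x) + x - (m ∸ x) + y ∣       ≡⟨ NatP.∣m+n-m+o∣≡∣n-o∣ (m ∸ x) x y ⟩
  Nat.∣ x - y ∣                           ≡⟨ distance-std x y ⟨
  ∣ x - y ∣                               ∎
  where open ≡-Reasoning

isOne : ℕ → ℕ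
isOne 1 = 1
isOne _ = 0

P-spec : ∀ m (a b : Fin (suc m)) → P m a b ≡ isOne ∣ toℕ a - toℕ b ∣
P-spec m a b with ∣ toℕ a - toℕ b ∣
... | 0 = refl
... | 1 = refl
... | suc (suc _) = refl

P-edge : ∀ m (a b : Fin (suc m)) → ∣ toℕ a - toℕ b ∣ ≡ 1 → P m a b ≡ 1
P-edge m a b d = trans (P-spec m a b) (cong isOne d)

P-adjacent : ∀ m (a b : Fin (suc m)) → P m a b ≢ 0 → ∣ toℕ a - toℕ b ∣ ≡ 1
P-adjacent m a b P≢0 with ∣ toℕ a - toℕ b ∣ | P-spec m a b
... | 0 | P≡0 = ⊥-elim (P≢0 P≡0)
... | 1 | _ = refl
... | suc (suc _) | P≡0 = ⊥-elim (P≢0 P≡0)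

P-opposite : ∀ m (a b : Fin (suc m)) → P m (opposite a) (opposite b) ≡ P m a b
P-opposite m a b = begin
  P m (opposite a) (opposite b)                   ≡⟨ P-spec m (opposite a) (opposite b) ⟩
  isOne ∣ toℕ (opposite a) - toℕ (opposite b) ∣   ≡⟨ cong isOne (cong₂ ∣_-_∣ (FinP.opposite-prop a) (FinP.opposite-prop b)) ⟩
  isOne ∣ m ∸ toℕ a - m ∸ toℕ b ∣                 ≡⟨ cong isOne (distance-reflect m (toℕ a) (toℕ b) (bound a) (bound b)) ⟩
  isOne ∣ toℕ a - toℕ b ∣                         ≡⟨ P-spec m a b ⟨
  P m a b                                         ∎
  where
  open ≡-Reasoning
  bound : (a : Fin (suc m)) → toℕ a ≤ m
  bound a = NatP.≤-pred (FinP.toℕ<n a)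

precompose-automorphism : ∀ {k n} {π : Permutation′ n} {G : WGraph k} {f : Fin k → Fin n}
  (σ : Fin k → Fin k) → (∀ a → σ (σ a) ≡ a) → (∀ a b → G (σ a) (σ b) ≡ G a b) →
  IsIsoEmbedding π G f → IsIsoEmbedding π G (f ∘ σ)
precompose-automorphism {f = f} σ σσ G-σ (f-injective , f-weight , f-isolated) =
  (σ-injective ∘ f-injective) ,
  (λ a b a≢b → trans (f-weight (σ a) (σ b) (a≢b ∘ σ-injective)) (G-σ a b)) ,
  (λ u v u≢v u∉fσ → f-isolated u v u≢v (λ (c , fc≡u) → u∉fσ (σ c , trans (cong f (σσ c)) fc≡u)))
  where
  σ-injective : ∀ {a b} → σ a ≡ σ b → a ≡ b
  σ-injective {a} {b} e = trans (sym (σσ a)) (trans (cong σ e) (σσ b))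

nonIsolated-inImage : ∀ {k n} {π : Permutation′ n} {G : WGraph k} {f : Fin k → Fin n} →
  IsIsoEmbedding π G f → ∀ u v → u ≢ v → weight π u v ≢ 0 → InImage f u
nonIsolated-inImage {f = f} (_ , _ , f-isolated) u v u≢v w≢0 with FinP.any? (λ a → f a FinP.≟ u)
... | yes u∈f = u∈f
... | no u∉f = ⊥-elim (w≢0 (f-isolated u v u≢v u∉f))

embedded-adjacent : ∀ {m n} {π : Permutation′ n} {f : Fin (suc m) → Fin n} →
  IsIsoEmbedding π (P m) f → ∀ a b → f a ≢ f b → weight π (f a) (f b) ≢ 0 →
  ∣ toℕ a - toℕ b ∣ ≡ 1
embedded-adjacent {m} (_ , f-weight , _) a b fa≢fb w≢0 =
  P-adjacent m a b (λ P≡0 → w≢0 (trans (f-weight a b (fa≢fb ∘ cong _)) P≡0))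

module Digraph {n} (π : Permutation′ n) where

  arc-irrefl : ∀ {x} → ¬ Arc π x x
  arc-irrefl (x<x , _) = FinP.<-irrefl refl x<x

  arc-trans : ∀ {x y z} → Arc π x y → Arc π y z → Arc π x z
  arc-trans (y<x , πy<πx) (z<y , πz<πy) = FinP.<-trans z<y y<x , FinP.<-trans πz<πy πy<πx

  arc-dominated : ∀ {w x z} → Arc π w x → term π z ≤ᶠ term π x → z < w → Arc π w z
  arc-dominated (_ , πx<πw) πz≤πx z<w = z<w , NatP.≤-<-trans πz≤πx πx<πw

  no-arc-term≤ : ∀ {x z} → x < z → ¬ Arc π z x → term π z ≤ᶠ term π x
  no-arc-term≤ x<z ¬arc = NatP.≮⇒≥ (λ πx<πz → ¬arc (x<z , πx<πz))

  common? : ∀ u v → Decidable (λ k → Arc π u k × Arc π v k)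
  common? u v k = arc? π u k ×-dec arc? π v k

  weight≢0-common : ∀ u v → weight π u v ≢ 0 → Σ (Fin n) (λ k → Arc π u k × Arc π v k)
  weight≢0-common u v w≢0 with filter (common? u v) (allFin n) in eq
  ... | [] = ⊥-elim (w≢0 refl)
  ... | k ∷ _ = k , proj₂ (∈-filter⁻ (common? u v) {xs = allFin n} (subst (k ∈_) (sym eq) (here refl)))

  common-weight≢0 : ∀ u v k → Arc π u k → Arc π v k → weight π u v ≢ 0
  common-weight≢0 u v k uk vk w≡0 =
    NatP.<-irrefl (sym w≡0) (filter-some (common? u v) (Any.map (λ { refl → uk , vk }) (∈-allFin k)))

  -- a chosen common out-neighbour of u and v (u itself if there is none)
  commonOut : Fin n → Fin n → Fin n
  commonOut u v with weight π u v Nat.≟ 0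
  ... | yes _ = u
  ... | no w≢0 = proj₁ (weight≢0-common u v w≢0)

  commonOut-arcs : ∀ u v → weight π u v ≢ 0 → Arc π u (commonOut u v) × Arc π v (commonOut u v)
  commonOut-arcs u v w≢0 with weight π u v Nat.≟ 0
  ... | yes w≡0 = ⊥-elim (w≢0 w≡0)
  ... | no w≢0′ = proj₂ (weight≢0-common u v w≢0′)

module Zigzag {a ℓ₁ ℓ₂} (O : StrictTotalOrder a ℓ₁ ℓ₂) where
  open StrictTotalOrder O using (Carrier; _≈_; compare; irrefl; module Eq) renaming (_<_ to _≺_)

  Between : Carrier → Carrier → Carrier → Set ℓ₂
  Between x z y = (x ≺ z × z ≺ y) ⊎ (y ≺ z × z ≺ x)

  not-between-left : ∀ {x y} → ¬ Between x x y
  not-between-left (inj₁ (x≺x , _)) = irrefl Eq.refl x≺x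
  not-between-left (inj₂ (_ , x≺x)) = irrefl Eq.refl x≺x

  not-between-right : ∀ {x y} → ¬ Between x y y
  not-between-right (inj₁ (_ , y≺y)) = irrefl Eq.refl y≺y
  not-between-right (inj₂ (y≺y , _)) = irrefl Eq.refl y≺y

  zigzag : ∀ {x y z} → ¬ y ≈ z → ¬ x ≈ z → ¬ Between x z y → ¬ Between y x z →
    (x ≺ y → y ≺ z) × (y ≺ x → z ≺ y)
  zigzag {x} {y} {z} y≉z x≉z z∉xy x∉yz = upwards , downwards
    where
    upwards : x ≺ y → y ≺ z
    upwards x≺y with compare y z | compare x z
    ... | tri< y≺z _ _ | _ = y≺z
    ... | tri≈ _ y≈z _ | _ = ⊥-elim (y≉z y≈z)
    ... | tri> _ _ z≺y | tri< x≺z _ _ = ⊥-elim (z∉xy (inj₁ (x≺z , z≺y)))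
    ... | tri> _ _ z≺y | tri≈ _ x≈z _ = ⊥-elim (x≉z x≈z)
    ... | tri> _ _ z≺y | tri> _ _ z≺x = ⊥-elim (x∉yz (inj₂ (z≺x , x≺y)))
    downwards : y ≺ x → z ≺ y
    downwards y≺x with compare y z | compare x z
    ... | tri> _ _ z≺y | _ = z≺y
    ... | tri≈ _ y≈z _ | _ = ⊥-elim (y≉z y≈z)
    ... | tri< y≺z _ _ | tri< x≺z _ _ = ⊥-elim (x∉yz (inj₁ (y≺x , x≺z)))
    ... | tri< y≺z _ _ | tri≈ _ x≈z _ = ⊥-elim (x≉z x≈z)
    ... | tri< y≺z _ _ | tri> _ _ z≺x = ⊥-elim (z∉xy (inj₂ (y≺z , z≺x)))

chain : ∀ {a ℓ} {A : Set a} (R : A → A → Set ℓ) (s : ℕ → A) (m : ℕ) → R (s 0) (s 1) →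
  (∀ j → suc (suc (suc j)) ≤ m → R (s j) (s (suc j)) → R (s (suc j)) (s (suc (suc j)))) →
  ∀ j → suc (suc j) ≤ m → R (s j) (s (suc j))
chain R s m first next zero _ = first
chain R s m first next (suc j) j+3≤m = next j j+3≤m (chain R s m first next j (NatP.<⇒≤ j+3≤m))

record Oriented {n} (π : Permutation′ n) (m : ℕ) (F : ℕ → Fin n) : Set where
  field
    left-to-right : ∀ i → suc (suc i) ≤ m → F i < F (suc i)
    last-right    : ∀ a → suc (suc a) ≡ m → F a < F m
    last-below    : ∀ k → suc (suc k) ≡ m → term π (F m) < term π (F 1)

record SinkPath {n} (π : Permutation′ n) (m : ℕ) (F : ℕ → Fin n) : Set where
  field
    sink         : ℕ → Fin n
    sink-arcs    : ∀ j → suc j ≤ m → Arc π (F j) (sink j) × Arc π (F (suc j)) (sink j)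
    sink-sources : ∀ j → suc j ≤ m → ∀ w → Arc π w (sink j) → w ≡ F j ⊎ w ≡ F (suc j)
    F-injective  : ∀ a b → a ≤ m → b ≤ m → F a ≡ F b → a ≡ b

module SinkPathProperties {n} {π : Permutation′ n} {m : ℕ} {F : ℕ → Fin n} (S : SinkPath π m F) where
  open SinkPath S
  open Digraph π
  open Zigzag (FinP.<-strictTotalOrder n) using (Between; not-between-left; not-between-right; zigzag)

  source-index : ∀ {j a} → suc j ≤ m → a ≤ m → Arc π (F a) (sink j) → a ≡ j ⊎ a ≡ suc j
  source-index {j} {a} j<m a≤m arc with sink-sources j j<m (F a) arc
  ... | inj₁ Fa≡Fj = inj₁ (F-injective a j a≤m (NatP.<⇒≤ j<m) Fa≡Fj)
  ... | inj₂ Fa≡Fj+1 = inj₂ (F-injective a (suc j) a≤m j<m Fa≡Fj+1)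

  -- the sinks form an antichain of D(π): both sources of sink l would point to sink j
  no-arc-between-sinks : ∀ {j l} → suc j ≤ m → suc l ≤ m → ¬ Arc π (sink l) (sink j)
  no-arc-between-sinks {j} {l} j<m l<m arc
    with source-index j<m (NatP.<⇒≤ l<m) (arc-trans (proj₁ (sink-arcs l l<m)) arc)
       | source-index j<m l<m (arc-trans (proj₂ (sink-arcs l l<m)) arc)
  ... | inj₁ refl | inj₂ refl = arc-irrefl arc
  ... | inj₁ refl | inj₁ ()
  ... | inj₂ refl | inj₁ ()
  ... | inj₂ refl | inj₂ ()

  sink-antitone : ∀ {j l} → suc j ≤ m → suc l ≤ m → sink j < sink l → term π (sink l) ≤ᶠ term π (sink j)
  sink-antitone j<m l<m Kj<Kl = no-arc-term≤ Kj<Kl (no-arc-between-sinks j<m l<m)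

  sink-injective : ∀ {j l} → suc j ≤ m → suc l ≤ m → sink j ≡ sink l → j ≡ l
  sink-injective {j} {l} j<m l<m Kj≡Kl
    with source-index l<m (NatP.<⇒≤ j<m) (subst (Arc π (F j)) Kj≡Kl (proj₁ (sink-arcs j j<m)))
       | source-index l<m j<m (subst (Arc π (F (suc j))) Kj≡Kl (proj₂ (sink-arcs j j<m)))
  ... | inj₁ j≡l | _ = j≡l
  ... | inj₂ refl | inj₁ ()
  ... | inj₂ refl | inj₂ ()

  -- no sink lies strictly between the sinks of two consecutive edges: F (j+1)
  -- points to both of them and hence to every sink in between
  no-sink-between : ∀ {j l} → suc (suc j) ≤ m → suc l ≤ m → ¬ Between (sink j) (sink l) (sink (suc j))
  no-sink-between {j} {l} j+1<m l<m between with source-index l<m (NatP.<⇒≤ j+1<m) (F[j+1]→Kl between)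
    where
    F[j+1]→Kl : Between (sink j) (sink l) (sink (suc j)) → Arc π (F (suc j)) (sink l)
    F[j+1]→Kl (inj₁ (Kj<Kl , Kl<Kj+1)) =
      arc-dominated (proj₂ (sink-arcs j (NatP.<⇒≤ j+1<m))) (sink-antitone (NatP.<⇒≤ j+1<m) l<m Kj<Kl)
        (FinP.<-trans Kl<Kj+1 (proj₁ (proj₁ (sink-arcs (suc j) j+1<m))))
    F[j+1]→Kl (inj₂ (Kj+1<Kl , Kl<Kj)) =
      arc-dominated (proj₁ (sink-arcs (suc j) j+1<m)) (sink-antitone j+1<m l<m Kj+1<Kl)
        (FinP.<-trans Kl<Kj (proj₁ (proj₂ (sink-arcs j (NatP.<⇒≤ j+1<m)))))
  ... | inj₁ refl = not-between-right between
  ... | inj₂ refl = not-between-left between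

  same-direction : ∀ j → suc (suc (suc j)) ≤ m →
    (sink j < sink (suc j) → sink (suc j) < sink (suc (suc j))) ×
    (sink (suc j) < sink j → sink (suc (suc j)) < sink (suc j))
  same-direction j j+2<m = zigzag
    (λ K≡K → j+1≢j+2 (sink-injective j+1<m j+2<m K≡K))
    (λ K≡K → j≢j+2 (sink-injective j<m j+2<m K≡K))
    (no-sink-between j+1<m j+2<m)
    (no-sink-between j+2<m j<m)
    where
    j+1<m : suc (suc j) ≤ m
    j+1<m = NatP.<⇒≤ j+2<m
    j<m : suc j ≤ m
    j<m = NatP.<⇒≤ j+1<m
    j+1≢j+2 : suc j ≢ suc (suc j)
    j+1≢j+2 ()
    j≢j+2 : j ≢ suc (suc j)
    j≢j+2 ()

  Increasing : Set
  Increasing = ∀ j → suc (suc j) ≤ m → sink j < sink (suc j)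

  increasing : sink 0 < sink 1 → Increasing
  increasing K₀<K₁ = chain _<_ sink m K₀<K₁ (λ j j+2<m → proj₁ (same-direction j j+2<m))

  decreasing : sink 1 < sink 0 → ∀ j → suc (suc j) ≤ m → sink (suc j) < sink j
  decreasing K₁<K₀ = chain (λ x y → y < x) sink m K₁<K₀ (λ j j+2<m → proj₂ (same-direction j j+2<m))

  -- with increasing sinks, F i lies left of sink (i+1): otherwise F i would point to it
  source-before-next-sink : Increasing → ∀ i → suc (suc i) ≤ m → F i ≤ᶠ sink (suc i)
  source-before-next-sink inc i i+1<m = NatP.≮⇒≥ Fi↛Ki+1
    where
    Fi↛Ki+1 : ¬ sink (suc i) < F i
    Fi↛Ki+1 Ki+1<Fi with source-index i+1<m (NatP.<⇒≤ (NatP.<⇒≤ i+1<m))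
      (arc-dominated (proj₁ (sink-arcs i (NatP.<⇒≤ i+1<m))) (sink-antitone (NatP.<⇒≤ i+1<m) i+1<m (inc i i+1<m)) Ki+1<Fi)
    ... | inj₁ ()
    ... | inj₂ ()

  sink-terms-decrease : Increasing → ∀ j → suc j ≤ m → term π (sink j) ≤ᶠ term π (sink 0)
  sink-terms-decrease inc zero _ = NatP.≤-refl
  sink-terms-decrease inc (suc j) j<m =
    NatP.≤-trans (sink-antitone (NatP.<⇒≤ j<m) j<m (inc j j<m)) (sink-terms-decrease inc j (NatP.<⇒≤ j<m))

  oriented : Increasing → Oriented π m F
  oriented inc = record
    { left-to-right = λ i i+1<m →
        NatP.≤-<-trans (source-before-next-sink inc i i+1<m) (proj₁ (proj₁ (sink-arcs (suc i) i+1<m)))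
    ; last-right = λ { a refl →
        NatP.≤-<-trans (source-before-next-sink inc a NatP.≤-refl) (proj₁ (proj₂ (sink-arcs (suc a) NatP.≤-refl))) }
    ; last-below = λ { k refl →
        NatP.≤-<-trans (NatP.≤-trans (last-below-sink k refl) (sink-terms-decrease inc k (NatP.<⇒≤ NatP.≤-refl)))
          (proj₂ (proj₂ (sink-arcs 0 (s≤s z≤n)))) }
    }
    where
    -- F m does not point to sink (m-2), which lies left of it
    last-below-sink : ∀ k → suc (suc k) ≡ m → term π (F m) ≤ᶠ term π (sink k)
    last-below-sink k refl = NatP.≮⇒≥ Fm↛Kk
      where
      Fm↛Kk : ¬ term π (sink k) < term π (F (suc (suc k)))
      Fm↛Kk πKk<πFm with source-index (NatP.<⇒≤ NatP.≤-refl) NatP.≤-refl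
        (FinP.<-trans (inc k NatP.≤-refl) (proj₁ (proj₂ (sink-arcs (suc k) NatP.≤-refl))) , πKk<πFm)
      ... | inj₁ ()
      ... | inj₂ ()

-- reading an index of ℕ as a vertex of P m, truncating at m
clamp : (m : ℕ) → ℕ → Fin (suc m)
clamp m zero = Fin.zero
clamp zero (suc a) = Fin.zero
clamp (suc m) (suc a) = Fin.suc (clamp m a)

toℕ-clamp : ∀ m a → a ≤ m → toℕ (clamp m a) ≡ a
toℕ-clamp m zero _ = refl
toℕ-clamp (suc m) (suc a) (s≤s a≤m) = cong suc (toℕ-clamp m a a≤m)

clamp-toℕ : ∀ m (i : Fin (suc m)) → clamp m (toℕ i) ≡ i
clamp-toℕ m Fin.zero = refl
clamp-toℕ (suc m) (Fin.suc i) = cong Fin.suc (clamp-toℕ m i)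

opposite-clamp : ∀ m (a : Fin (suc m)) → opposite a ≡ clamp m (m ∸ toℕ a)
opposite-clamp m a =
  FinP.toℕ-injective (trans (FinP.opposite-prop a) (sym (toℕ-clamp m (m ∸ toℕ a) (NatP.m∸n≤m m (toℕ a)))))

clamp-injective : ∀ {m a b} → a ≤ m → b ≤ m → clamp m a ≡ clamp m b → a ≡ b
clamp-injective {m} {a} {b} a≤m b≤m e =
  trans (sym (toℕ-clamp m a a≤m)) (trans (cong toℕ e) (toℕ-clamp m b b≤m))

reflect-suc : ∀ {m j} → suc j ≤ m → suc (m ∸ suc j) ≡ m ∸ j
reflect-suc j<m = sym (NatP.+-∸-assoc 1 j<m)

reflect-bound : ∀ {m j} → suc j ≤ m → suc (m ∸ suc j) ≤ m
reflect-bound {m} {j} j<m = subst (_≤ m) (sym (reflect-suc j<m)) (NatP.m∸n≤m m j)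

reverseSinkPath : ∀ {n} {π : Permutation′ n} {m F} → SinkPath π m F → SinkPath π m (λ j → F (m ∸ j))
reverseSinkPath {π = π} {m} {F} S = record
  { sink         = λ j → sink (m ∸ suc j)
  ; sink-arcs    = λ j j<m →
      subst (λ x → Arc π (F x) (sink (m ∸ suc j))) (reflect-suc j<m) (proj₂ (sink-arcs _ (reflect-bound j<m))) ,
      proj₁ (sink-arcs _ (reflect-bound j<m))
  ; sink-sources = λ j j<m w arc →
      Sum.swap (Sum.map₂ (λ w≡F → trans w≡F (cong F (reflect-suc j<m))) (sink-sources _ (reflect-bound j<m) w arc))
  ; F-injective  = λ a b a≤m b≤m Fa≡Fb →
      NatP.∸-cancelˡ-≡ a≤m b≤m (F-injective (m ∸ a) (m ∸ b) (NatP.m∸n≤m m a) (NatP.m∸n≤m m b) Fa≡Fb)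
  }
  where open SinkPath S

module FromEmbedding {m n} {π : Permutation′ n} {f : Fin (suc m) → Fin n}
  (embedding : IsIsoEmbedding π (P m) f) where
  open Digraph π

  F : ℕ → Fin n
  F j = f (clamp m j)

  consecutive-adjacent : ∀ j → suc j ≤ m → weight π (F j) (F (suc j)) ≢ 0
  consecutive-adjacent j j<m w≡0 = NatP.1+n≢n (trans (sym (P-edge m a b distance)) (trans (sym weight≡P) w≡0))
    where
    a b : Fin (suc m)
    a = clamp m j
    b = clamp m (suc j)
    distance : ∣ toℕ a - toℕ b ∣ ≡ 1
    distance = trans (cong₂ ∣_-_∣ (toℕ-clamp m j (NatP.<⇒≤ j<m)) (toℕ-clamp m (suc j) j<m)) (distance-suc j)
    weight≡P : weight π (F j) (F (suc j)) ≡ P m a b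
    weight≡P = proj₁ (proj₂ embedding) a b (λ a≡b → NatP.1+n≢n (sym (clamp-injective (NatP.<⇒≤ j<m) j<m a≡b)))

  neighbour-distance : ∀ a → a ≤ m → ∀ c → f c ≢ F a → weight π (f c) (F a) ≢ 0 → ∣ toℕ c - a ∣ ≡ 1
  neighbour-distance a a≤m c fc≢Fa w≢0 =
    trans (cong (λ t → ∣ toℕ c - t ∣) (sym (toℕ-clamp m a a≤m))) (embedded-adjacent {m} {π = π} {f} embedding c (clamp m a) fc≢Fa w≢0)

  sink : ℕ → Fin n
  sink j = commonOut (F j) (F (suc j))

  sink-arcs : ∀ j → suc j ≤ m → Arc π (F j) (sink j) × Arc π (F (suc j)) (sink j)
  sink-arcs j j<m = commonOut-arcs (F j) (F (suc j)) (consecutive-adjacent j j<m)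

  -- a third in-neighbour w of sink j would be a path vertex adjacent to both j and j+1
  no-third-source : ∀ j → suc j ≤ m → ∀ w → w ≢ F j → w ≢ F (suc j) → ¬ Arc π w (sink j)
  no-third-source j j<m w w≢Fj w≢Fj+1 arc
    with nonIsolated-inImage {π = π} {P m} {f} embedding w (F j) w≢Fj (common-weight≢0 _ _ _ arc (proj₁ (sink-arcs j j<m)))
  ... | c , refl = distance-parity (toℕ c) j
    (neighbour-distance j (NatP.<⇒≤ j<m) c w≢Fj (common-weight≢0 _ _ _ arc (proj₁ (sink-arcs j j<m))))
    (neighbour-distance (suc j) j<m c w≢Fj+1 (common-weight≢0 _ _ _ arc (proj₂ (sink-arcs j j<m))))

  sinkPath : SinkPath π m F
  sinkPath = record
    { sink         = sink
    ; sink-arcs    = sink-arcs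
    ; sink-sources = sources
    ; F-injective  = λ a b a≤m b≤m Fa≡Fb → clamp-injective a≤m b≤m (proj₁ embedding Fa≡Fb)
    }
    where
    sources : ∀ j → suc j ≤ m → ∀ w → Arc π w (sink j) → w ≡ F j ⊎ w ≡ F (suc j)
    sources j j<m w arc with w FinP.≟ F j | w FinP.≟ F (suc j)
    ... | yes w≡Fj | _ = inj₁ w≡Fj
    ... | no _ | yes w≡Fj+1 = inj₂ w≡Fj+1
    ... | no w≢Fj | no w≢Fj+1 = ⊥-elim (no-third-source j j<m w w≢Fj w≢Fj+1 arc)

  module S = SinkPathProperties sinkPath

  orient : 2 ≤ m → Σ (Fin (suc m) → Fin n) (λ p → IsIsoEmbedding π (P m) p ×
             Σ (ℕ → Fin n) (λ G → Oriented π m G × (∀ a → p a ≡ G (toℕ a))))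
  orient 2≤m@(s≤s (s≤s z≤n)) with FinP.<-cmp (sink 0) (sink 1)
  ... | tri< K₀<K₁ _ _ =
    f , embedding , F , S.oriented (S.increasing K₀<K₁) , λ a → cong f (sym (clamp-toℕ m a))
  ... | tri≈ _ K₀≡K₁ _ with S.sink-injective (s≤s z≤n) 2≤m K₀≡K₁
  ...   | ()
  orient (s≤s (s≤s z≤n)) | tri> _ _ K₁<K₀ =
    f ∘ opposite , precompose-automorphism {π = π} {P m} {f} opposite FinP.opposite-involutive (P-opposite m) embedding ,
    (λ j → F (m ∸ j)) , R.oriented (R.increasing (S.decreasing K₁<K₀ _ NatP.≤-refl)) ,
    λ a → cong f (opposite-clamp m a)
    where module R = SinkPathProperties (reverseSinkPath sinkPath)

oriented-fin : ∀ {n} {π : Permutation′ n} {m F} → Oriented π m F → 2 ≤ m →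
  (p : Fin (suc m) → Fin n) → (∀ a → p a ≡ F (toℕ a)) →
  (∀ (i j : Fin (suc m)) → toℕ j ≡ suc (toℕ i) → toℕ i + 2 ≤ m → p i < p j)
  × (∀ (a : Fin (suc m)) → toℕ a + 2 ≡ m → p a < p (fromℕ m))
  × (∀ (a : Fin (suc m)) → toℕ a ≡ 1 → term π (p (fromℕ m)) < term π (p a))
oriented-fin {π = π} {m} {F} O (s≤s (s≤s z≤n)) p p≡F =
  (λ i j j≡i+1 i+2≤m → subst₂ _<_ (sym (p-at i refl)) (sym (p-at j j≡i+1))
     (left-to-right (toℕ i) (subst (_≤ m) (NatP.+-comm (toℕ i) 2) i+2≤m))) ,
  (λ a a+2≡m → subst₂ _<_ (sym (p-at a refl)) (sym (p-at (fromℕ m) (FinP.toℕ-fromℕ m)))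
     (last-right (toℕ a) (trans (NatP.+-comm 2 (toℕ a)) a+2≡m))) ,
  (λ a a≡1 → subst₂ (λ x y → term π x < term π y) (sym (p-at (fromℕ m) (FinP.toℕ-fromℕ m))) (sym (p-at a a≡1))
     (last-below _ refl))
  where
  open Oriented O
  p-at : ∀ a {x} → toℕ a ≡ x → p a ≡ F x
  p-at a toℕa≡x = trans (p≡F a) (cong F toℕa≡x)

mainTheorem8 : (m n : ℕ) → 2 ≤ m → (π : Permutation′ n) → InWInv π (P m) →
    Σ (Fin (suc m) → Fin n) (λ p →
      IsIsoEmbedding π (P m) p
      × (∀ (i j : Fin (suc m)) → toℕ j ≡ suc (toℕ i) → toℕ i + 2 ≤ m → p i < p j)
      × (∀ (a : Fin (suc m)) → toℕ a + 2 ≡ m → p a < p (fromℕ m))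
      × (∀ (a : Fin (suc m)) → toℕ a ≡ 1 → term π (p (fromℕ m)) < term π (p a)))
mainTheorem8 m n 2≤m π (f , embedding) with FromEmbedding.orient {m} {n} {π} {f} embedding 2≤m
... | p , p-embedding , F , oriented-F , p≡F = p , p-embedding , oriented-fin oriented-F 2≤m p p≡F
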